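{- Let $n\ge1$, $h:[n]\to[n]$ a Hessenberg function, $i\in\mathbb{Z}$ with $i\ge0$, and $\lambda\vdash n$ a partition with $k$ parts. Then \[ \mathcal{W}_i(\mathbb{J}_\lambda,h)=\bigsqcup_{T\in\mathrm{SK}_k(\Gamma_h)}\mathcal{W}_i(\mathbb{J}_\lambda,h,T). \]
   Context: A Hessenberg function is a nondecreasing $h:[n]\to[n]$ with $h(j)\ge j$. Roots $t_a-t_b$ ($a\ne b$) identified with pairs $(a,b)$; $\Phi^-=\{t_a-t_b:a>b\}$, $\Phi^+=\{t_a-t_b:a<b\}$; $\Delta=\{\alpha_j=t_j-t_{j+1}:1\le j\le n-1\}$; $w(t_a-t_b)=t_{w(a)}-t_{w(b)}$. $\Phi_h^-=\{t_a-t_b:b<a\le h(b)\}$, $\Phi_h=\Phi_h^-\sqcup\Phi^+$, $I_h=\Phi^-\setminus\Phi_h^-$, $\mathrm{inv}(w)=\{(a,b):a>b,w(a)<w(b)\}$, $\mathrm{inv}_h(w)=\mathrm{inv}(w)\cap\Phi_h^-$. For $J\subseteq\Delta$, $\mathcal{W}_i(J,h)=\{w\in\mathfrak{S}_n:w^{ -1}(J)\subseteq\Phi_h,\ w^{ -1}(\Delta\setminus J)\subseteq I_h,\ |\mathrm{inv}_h(w)|=i\}$. For $\mu=(\mu_1,\dots,\mu_p)\vdash n$ with $p$ parts, $J_\mu=\Delta\setminus\{\alpha_{\mu_1},\dots,\alpha_{\mu_1+\cdots+\mu_{p-1}}\}$ and $\mathbb{J}_\lambda=\Delta\setminus J_{\lambda^\vee}$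 ($\lambda^\vee$ the dual partition). The incomparability graph $\Gamma_h$ has vertex set $[n]$ and edges $\{a,b\}$ with $a<b\le h(a)$. $\mathrm{SK}_k(\Gamma_h)$ is the set of independent sets of vertices of $\Gamma_h$ of cardinality $k$ (equivalently, sink sets of size $k$ of acyclic orientations of $\Gamma_h$). For $T=\{\ell_1<\cdots<\ell_k\}\in\mathrm{SK}_k(\Gamma_h)$ and $\lambda$ with $k$ parts, $\mathcal{W}_i(\mathbb{J}_\lambda,h,T)=\{w\in\mathcal{W}_i(\mathbb{J}_\lambda,h): w(\ell_j)=k-j+1\text{ for }1\le j\le k\}$. -}

module Defs where

open import Data.Nat as ℕ using (ℕ; zero; suc; _+_; _∸_; _≤_; _<_; _≤?_)
open import Data.Fin as Fin using (Fin; toℕ)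
open import Data.Fin.Permutation using (Permutation′; _⟨$⟩ʳ_; _⟨$⟩ˡ_)
open import Data.List as List using (List; []; _∷_; length; filter; allFin; cartesianProduct; take; map; upTo; foldr)
open import Data.Vec as Vec using (Vec)
open import Data.Nat.ListAction using (sum)
open import Data.Product using (Σ; _×_; _,_; ∃; proj₁; proj₂)
open import Data.Sum using (_⊎_)
open import Relation.Binary.PropositionalEquality using (_≡_; _≢_)
open import Relation.Nullary using (¬_)
open import Relation.Nullary.Decidable using (_×-dec_)

-- Conventions: [n] = {1,…,n} is represented by Fin n, the element a : Fin n
-- standing for the integer pos a = toℕ a + 1.  Order on [n] is the order of Fin n.

pos : ∀ {n} → Fin n → ℕ
pos a = suc (toℕ a)

IsHessenberg : (n : ℕ) → (Fin n → Fin n) → Set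
IsHessenberg n h = (∀ (a b : Fin n) → a Fin.≤ b → h a Fin.≤ h b) × (∀ (j : Fin n) → j Fin.≤ h j)

-- A root t_a - t_b (a ≠ b) is the pair (a , b).
-- Φ_h^- = { t_a - t_b : b < a ≤ h(b) }
InΦh⁻ : ∀ {n} → (Fin n → Fin n) → Fin n → Fin n → Set
InΦh⁻ h a b = (b Fin.< a) × (a Fin.≤ h b)

InΦ⁺ : ∀ {n} → Fin n → Fin n → Set
InΦ⁺ a b = a Fin.< b

InΦh : ∀ {n} → (Fin n → Fin n) → Fin n → Fin n → Set
InΦh h a b = InΦh⁻ h a b ⊎ InΦ⁺ a b

InIh : ∀ {n} → (Fin n → Fin n) → Fin n → Fin n → Set
InIh h a b = (b Fin.< a) × ¬ InΦh⁻ h a b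

InvhPred : ∀ {n} → (Fin n → Fin n) → Permutation′ n → Fin n × Fin n → Set
InvhPred h w (a , b) = ((b Fin.< a) × ((w ⟨$⟩ʳ a) Fin.< (w ⟨$⟩ʳ b))) × InΦh⁻ h a b

invhDec : ∀ {n} (h : Fin n → Fin n) (w : Permutation′ n) (p : Fin n × Fin n) →
          Relation.Nullary.Dec (InvhPred h w p)
invhDec h w (a , b) =
  ((b Fin.<? a) ×-dec ((w ⟨$⟩ʳ a) Fin.<? (w ⟨$⟩ʳ b))) ×-dec ((b Fin.<? a) ×-dec (a Fin.≤? h b))

invhCount : ∀ {n} → (Fin n → Fin n) → Permutation′ n → ℕ
invhCount {n} h w = length (filter (invhDec h w) (cartesianProduct (allFin n) (allFin n)))

-- Subsets J ⊆ Δ are given as predicates on the index j of α_j (1 ≤ j ≤ n-1).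
-- The simple root α_j = t_j - t_{j+1} is the pair (a , b) with pos a = j, pos b = j+1.
-- W_i(J,h) membership:
InW : (n : ℕ) → (Fin n → Fin n) → (ℕ → Set) → ℕ → Permutation′ n → Set
InW n h J i w =
  (∀ (a b : Fin n) → pos b ≡ suc (pos a) → J (pos a) →
      InΦh h (w ⟨$⟩ˡ a) (w ⟨$⟩ˡ b))
  × (∀ (a b : Fin n) → pos b ≡ suc (pos a) → ¬ J (pos a) →
      InIh h (w ⟨$⟩ˡ a) (w ⟨$⟩ˡ b))
  × (invhCount h w ≡ i)

IsPartition : (n k : ℕ) → Vec ℕ k → Set
IsPartition n k lam =
  (∀ (r : Fin k) → 1 ≤ Vec.lookup lam r)
  × (∀ (r s : Fin k) → r Fin.≤ s → Vec.lookup lam s ≤ Vec.lookup lam r)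
  × (Vec.sum lam ≡ n)

dualPart : ∀ {k} → Vec ℕ k → ℕ → ℕ
dualPart lam m = length (filter (m ≤?_) (Vec.toList lam))

maxPart : ∀ {k} → Vec ℕ k → ℕ
maxPart lam = Vec.foldr _ ℕ._⊔_ 0 lam

dual : ∀ {k} → Vec ℕ k → List ℕ
dual lam = map (λ m → dualPart lam (suc m)) (upTo (maxPart lam))

InJμ : (n : ℕ) → List ℕ → ℕ → Set
InJμ n μ j = (1 ≤ j) × (j ≤ n ∸ 1)
  × ¬ (∃ λ m → (1 ≤ m) × (m ≤ length μ ∸ 1) × (j ≡ sum (take m μ)))

Inℐλ : (n : ℕ) → ∀ {k} → Vec ℕ k → ℕ → Set
Inℐλ n lam j = (1 ≤ j) × (j ≤ n ∸ 1) × ¬ InJμ n (dual lam) j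

-- SK_k(Γ_h): a k-element independent set T = {ℓ_1 < ⋯ < ℓ_k} of Γ_h,
-- represented by its increasing enumeration ℓ : Fin k → Fin n.
-- Edges of Γ_h: {a,b} with a < b ≤ h(a).
IsSK : ∀ {n} → (Fin n → Fin n) → (k : ℕ) → (Fin k → Fin n) → Set
IsSK h k ℓ =
  (∀ (r s : Fin k) → r Fin.< s → ℓ r Fin.< ℓ s)
  × (∀ (r s : Fin k) → ¬ ((ℓ r Fin.< ℓ s) × (ℓ s Fin.≤ h (ℓ r))))

-- W_i(J,h,T): w ∈ W_i(J,h) with w(ℓ_j) = k - j + 1 for 1 ≤ j ≤ k
-- (with r : Fin k standing for j = toℕ r + 1, so k - j + 1 = k ∸ toℕ r).
InWT : (n : ℕ) → (Fin n → Fin n) → (ℕ → Set) → ℕ → (k : ℕ) → (Fin k → Fin n) →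
       Permutation′ n → Set
InWT n h J i k ℓ w = InW n h J i w × (∀ (r : Fin k) → pos (w ⟨$⟩ʳ ℓ r) ≡ k ∸ toℕ r)

module Submission where

-- Write v = w⁻¹ for w ∈ W_i(𝕁_λ,h).  The first part of the dual
-- partition λ^∨ is k (the number of parts of λ), so every partial sum
-- λ^∨_1 + ⋯ + λ^∨_m (m ≥ 1) is at least k, and hence no simple root α_j with
-- 1 ≤ j < k lies in 𝕁_λ.  The defining condition of W_i(𝕁_λ,h) therefore puts
-- w⁻¹(α_j) into I_h for those j, i.e.  h(v(j+1)) < v(j).  Since h(x) ≥ x these
-- consecutive inequalities chain together:  h(v(b)) < v(a)  whenever
-- 1 ≤ a < b ≤ k.  Hence ℓ_r = v(k - r + 1) (r = 1,…,k) is increasing and no two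
-- of its values are joined by an edge of Γ_h: T = {ℓ_1 < ⋯ < ℓ_k} is a sink set
-- and w ∈ W_i(𝕁_λ,h,T).  The converse inclusion is immediate, and the union is
-- disjoint because w(ℓ_r) = k - r + 1 determines ℓ_r.

open import Defs
open import Data.Nat using (ℕ; _≤_)
open import Data.Fin using (Fin)
open import Data.Fin.Permutation using (Permutation′)
open import Data.Vec using (Vec)
open import Data.Product using (Σ; _×_; _,_; ∃)
open import Relation.Binary.PropositionalEquality using (_≡_)

open import Data.Nat using (zero; suc; _∸_; _<_; z≤n; s≤s; _≤?_)
import Data.Nat.Properties as ℕₚ
open import Data.Fin as Fin using (toℕ; opposite; inject≤; fromℕ<)
import Data.Fin.Properties as Finₚ
open import Data.Fin.Permutation using (_⟨$⟩ʳ_; _⟨$⟩ˡ_; inverseˡ; inverseʳ)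
open import Data.Vec as Vec using ([]; _∷_)
open import Data.List as List using (List; []; _∷_; length; take; map; upTo)
import Data.List.Properties as Listₚ
open import Data.Nat.ListAction using (sum)
open import Data.Product using (proj₁; proj₂)
open import Data.Sum using (_⊎_; inj₁; inj₂)
open import Data.Empty using (⊥-elim)
open import Relation.Nullary using (¬_; yes; no)
open import Relation.Binary.PropositionalEquality using (refl; sym; trans; cong; subst; subst₂)
open import Relation.Binary using (tri<; tri≈; tri>)
open import Function using (_∘_)

length≤sum : ∀ {k} (lam : Vec ℕ k) → (∀ r → 1 ≤ Vec.lookup lam r) → k ≤ Vec.sum lam
length≤sum []       _   = z≤n
length≤sum (x ∷ xs) pos = ℕₚ.+-mono-≤ (pos Fin.zero) (length≤sum xs (pos ∘ Fin.suc))

dualPart₁≡length : ∀ {k} (lam : Vec ℕ k) → (∀ r → 1 ≤ Vec.lookup lam r) → dualPart lam 1 ≡ k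
dualPart₁≡length []       _   = refl
dualPart₁≡length (x ∷ xs) pos =
  trans (cong length (Listₚ.filter-accept (1 ≤?_) (pos Fin.zero)))
        (cong suc (dualPart₁≡length xs (pos ∘ Fin.suc)))

map-upTo-head : (f : ℕ → ℕ) (M : ℕ) →
                map f (upTo M) ≡ [] ⊎ ∃ λ xs → map f (upTo M) ≡ f 0 ∷ xs
map-upTo-head f zero    = inj₁ refl
map-upTo-head f (suc M) = inj₂ (_ , refl)

dual-head : ∀ {k} (lam : Vec ℕ k) → (∀ r → 1 ≤ Vec.lookup lam r) →
            dual lam ≡ [] ⊎ ∃ λ xs → dual lam ≡ k ∷ xs
dual-head lam pos with map-upTo-head (λ m → dualPart lam (suc m)) (maxPart lam)
... | inj₁ empty     = inj₁ empty
... | inj₂ (xs , eq) = inj₂ (xs , trans eq (cong (List._∷ xs) (dualPart₁≡length lam pos)))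

-- A number below the head k of a list is none of its nonempty proper partial
-- sums, so α_j (j < k) is never removed from Δ when forming J_μ.
belowHead-notPartialSum : ∀ {k j} → j < k → (D : List ℕ) → (D ≡ [] ⊎ ∃ λ xs → D ≡ k ∷ xs) →
  ¬ (∃ λ m → (1 ≤ m) × (m ≤ length D ∸ 1) × (j ≡ sum (take m D)))
belowHead-notPartialSum j<k .[]       (inj₁ refl)        (suc m , _ , () , _)
belowHead-notPartialSum {k} j<k .(k ∷ xs) (inj₂ (xs , refl)) (suc m , _ , _ , j≡) =
  ℕₚ.<⇒≱ j<k (subst (k ≤_) (sym j≡) (ℕₚ.m≤m+n k _))

module PartitionFacts {n k : ℕ} (λp : Vec ℕ k) (P : IsPartition n k λp) where

  k≤n : k ≤ n
  k≤n = subst (k ≤_) (proj₂ (proj₂ P)) (length≤sum λp (proj₁ P))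

  -- The simple roots α_1,…,α_{k-1} all lie in J_{λ^∨}, hence outside 𝕁_λ.
  small-root∉𝕁 : ∀ j → 1 ≤ j → j < k → ¬ Inℐλ n λp j
  small-root∉𝕁 j 1≤j j<k (_ , _ , j∉J) =
    j∉J (1≤j , ℕₚ.∸-monoˡ-≤ 1 (ℕₚ.≤-trans j<k k≤n)
        , belowHead-notPartialSum j<k (dual λp) (dual-head λp (proj₁ P)))

chain-of-steps : ∀ {r} (R : ℕ → ℕ → Set r) (k : ℕ) →
  (∀ {a b c} → b < c → c < k → R a b → R b c → R a c) →
  (∀ m → suc m < k → R m (suc m)) →
  ∀ {m m'} → m < m' → m' < k → R m m'
chain-of-steps R k compose step {m} {suc p} (s≤s m≤p) p+1<k with ℕₚ.m≤n⇒m<n∨m≡n m≤p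
... | inj₂ refl = step m p+1<k
... | inj₁ m<p  = compose (ℕₚ.n<1+n p) p+1<k
    (chain-of-steps R k compose step m<p (ℕₚ.<-trans (ℕₚ.n<1+n p) p+1<k))
    (step p p+1<k)

module SinkSetOf {n : ℕ} (h : Fin n → Fin n) (H : IsHessenberg n h) {i k : ℕ}
                 (λp : Vec ℕ k) (P : IsPartition n k λp) (w : Permutation′ n)
                 (W : InW n h (Inℐλ n λp) i w) where
  open PartitionFacts λp P

  v : Fin n → Fin n
  v a = w ⟨$⟩ˡ a

  Above : ℕ → ℕ → Set
  Above m m' = ∀ (a b : Fin n) → toℕ a ≡ m → toℕ b ≡ m' → toℕ (h (v b)) < toℕ (v a)

  -- w⁻¹(α_{m+1}) ∈ I_h for m + 1 < k, which says exactly Above m (m+1).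
  consecutive : ∀ m → suc m < k → Above m (suc m)
  consecutive m m+1<k a b refl b≡ with proj₁ (proj₂ W) a b (cong suc b≡)
                                        (small-root∉𝕁 (pos a) (s≤s z≤n) m+1<k)
  ... | (vb<va , ∉Φh⁻) with toℕ (v a) ℕₚ.≤? toℕ (h (v b))
  ...   | yes va≤hvb = ⊥-elim (∉Φh⁻ (vb<va , va≤hvb))
  ...   | no  va≰hvb = ℕₚ.≰⇒> va≰hvb

  -- Composition uses h(x) ≥ x at the middle position.
  compose : ∀ {a b c} → b < c → c < k → Above a b → Above b c → Above a c
  compose {b = b} b<c c<k ab bc x z x≡ z≡ =
    ℕₚ.<-trans (ℕₚ.<-≤-trans (bc y z (Finₚ.toℕ-fromℕ< b<n) z≡) (proj₂ H (v y)))
               (ab x y x≡ (Finₚ.toℕ-fromℕ< b<n))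
    where
    b<n : b < n
    b<n = ℕₚ.<-trans b<c (ℕₚ.<-≤-trans c<k k≤n)
    y : Fin n
    y = fromℕ< b<n

  descent : ∀ (a b : Fin n) → a Fin.< b → toℕ b < k → toℕ (h (v b)) < toℕ (v a)
  descent a b a<b b<k = chain-of-steps Above k compose consecutive a<b b<k a b refl refl

  -- The rank r ∈ Fin k (0-based) sits at the 0-based position k - 1 - r of [n].
  slot : Fin k → Fin n
  slot r = inject≤ (opposite r) k≤n

  toℕ-slot : ∀ r → toℕ (slot r) ≡ k ∸ suc (toℕ r)
  toℕ-slot r = trans (Finₚ.toℕ-inject≤ (opposite r) k≤n) (Finₚ.opposite-prop r)

  slot<k : ∀ r → toℕ (slot r) < k
  slot<k r = subst (_< k) (sym (toℕ-slot r)) (ℕₚ.∸-monoʳ-< {k} {suc (toℕ r)} {0} (s≤s z≤n) (Finₚ.toℕ<n r))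

  slot-antitone : ∀ r s → r Fin.< s → slot s Fin.< slot r
  slot-antitone r s r<s = subst₂ _<_ (sym (toℕ-slot s)) (sym (toℕ-slot r))
                                 (ℕₚ.∸-monoʳ-< {k} (s≤s r<s) (Finₚ.toℕ<n s))

  ℓ : Fin k → Fin n
  ℓ r = v (slot r)

  h-separated : ∀ r s → r Fin.< s → h (ℓ r) Fin.< ℓ s
  h-separated r s r<s = descent (slot s) (slot r) (slot-antitone r s r<s) (slot<k r)

  increasing : ∀ r s → r Fin.< s → ℓ r Fin.< ℓ s
  increasing r s r<s = ℕₚ.≤-<-trans (proj₂ H (ℓ r)) (h-separated r s r<s)

  ℓ-isSK : IsSK h k ℓ
  ℓ-isSK = increasing , independent
    where
    independent : ∀ r s → ¬ ((ℓ r Fin.< ℓ s) × (ℓ s Fin.≤ h (ℓ r)))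
    independent r s (ℓr<ℓs , ℓs≤hℓr) with Finₚ.<-cmp r s
    ... | tri< r<s _ _ = ℕₚ.<⇒≱ (h-separated r s r<s) ℓs≤hℓr
    ... | tri≈ _ refl _ = ℕₚ.<-irrefl refl ℓr<ℓs
    ... | tri> _ _ s<r = ℕₚ.<-asym ℓr<ℓs (increasing s r s<r)

  ℓ-ranks : ∀ r → pos (w ⟨$⟩ʳ ℓ r) ≡ k ∸ toℕ r
  ℓ-ranks r = trans (cong pos (inverseʳ w))
                    (trans (cong suc (toℕ-slot r))
                           (sym (ℕₚ.+-∸-assoc 1 {k} {suc (toℕ r)} (Finₚ.toℕ<n r))))

  sinkSet : ∃ λ (ℓ : Fin k → Fin n) → IsSK h k ℓ × InWT n h (Inℐλ n λp) i k ℓ w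
  sinkSet = ℓ , ℓ-isSK , W , ℓ-ranks

ranks-determine : ∀ {n k} (ℓ ℓ' : Fin k → Fin n) (w : Permutation′ n) →
  (∀ r → pos (w ⟨$⟩ʳ ℓ r) ≡ k ∸ toℕ r) → (∀ r → pos (w ⟨$⟩ʳ ℓ' r) ≡ k ∸ toℕ r) →
  (r : Fin k) → ℓ r ≡ ℓ' r
ranks-determine ℓ ℓ' w rank rank' r =
  trans (sym (inverseˡ w)) (trans (cong (w ⟨$⟩ˡ_) same-image) (inverseˡ w))
  where
  same-image : w ⟨$⟩ʳ ℓ r ≡ w ⟨$⟩ʳ ℓ' r
  same-image = Finₚ.toℕ-injective (ℕₚ.suc-injective (trans (rank r) (sym (rank' r))))

proposition5p10 :
    (n : ℕ) → 1 ≤ n → (h : Fin n → Fin n) → IsHessenberg n h → (i : ℕ) →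
    (k : ℕ) → (λp : Vec ℕ k) → IsPartition n k λp →
    ((w : Permutation′ n) →
       (InW n h (Inℐλ n λp) i w →
          ∃ λ (ℓ : Fin k → Fin n) → IsSK h k ℓ × InWT n h (Inℐλ n λp) i k ℓ w)
       × ((∃ λ (ℓ : Fin k → Fin n) → IsSK h k ℓ × InWT n h (Inℐλ n λp) i k ℓ w) →
          InW n h (Inℐλ n λp) i w))
    × ((ℓ ℓ' : Fin k → Fin n) → IsSK h k ℓ → IsSK h k ℓ' → (w : Permutation′ n) →
       InWT n h (Inℐλ n λp) i k ℓ w → InWT n h (Inℐλ n λp) i k ℓ' w →
       (r : Fin k) → ℓ r ≡ ℓ' r)
proposition5p10 n _ h H i k λp P = covers , disjoint
  where
  InWT′ : (Fin k → Fin n) → Permutation′ n → Set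
  InWT′ = InWT n h (Inℐλ n λp) i k

  covers : (w : Permutation′ n) →
           (InW n h (Inℐλ n λp) i w → ∃ λ ℓ → IsSK h k ℓ × InWT′ ℓ w)
           × ((∃ λ ℓ → IsSK h k ℓ × InWT′ ℓ w) → InW n h (Inℐλ n λp) i w)
  covers w = SinkSetOf.sinkSet h H λp P w , λ { (_ , _ , W , _) → W }
  disjoint : (ℓ ℓ' : Fin k → Fin n) → IsSK h k ℓ → IsSK h k ℓ' → (w : Permutation′ n) →
             InWT′ ℓ w → InWT′ ℓ' w → (r : Fin k) → ℓ r ≡ ℓ' r
  disjoint ℓ ℓ' _ _ w (_ , rank) (_ , rank') = ranks-determine ℓ ℓ' w rank rank'
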